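{- Let $\mathcal{B}$ be a set of triples $B=(U,V,E)$, where $U$ and $V$ are disjoint vertex sets, $E$ is a set of edges on $U\cup V$, and $U$ is a minimum vertex cover of the graph $(U\cup V,E)$. Let $\ell,m,n\in\mathbb{N}$. Then for every triple $(U',V',E')$ in the range of the composed process $\mathcal{G}^3_m(\mathcal{G}^2_n(C(\mathcal{G}^1_{\mathcal{B},\ell,m,n})))$, the set $U'$ is a minimum vertex cover of the graph $(U'\cup V',E')$, it has size $\ell$, and the graph $(U'\cup V',E')$ has exactly $n$ vertices and $m$ edges.
   Context: Graphs are finite, simple, undirected; a vertex cover is a set of vertices meeting every edge. The processes are defined as follows. (1) Given $\mathcal{B}$ and $\ell,m,n$, $\mathcal{G}^1_{\mathcal{B},\ell,m,n}$ outputs, uniformly at random, a collection $S_1,\dots,S_k$ of elements of $\mathcal{B}$ (elements may repeat; the $S_i=(U_i,V_i,E_i)$ are taken as pairwise vertex-disjoint copies) such that $|\bigcup_{i=1}^k U_i|=\ell$, $|\bigcup_{i=1}^k V_i|+\ell\le n$ and $|\bigcup_{i=1}^k E_i|\le m$; then $C(S_1,\dots,S_k)=(\bigcup_i U_i,\bigcup_i V_i,\bigcup_i E_i)$. (2) For a triple $B=(U,V,E)$ with $|U|+|V|\le n$, $\mathcal{G}^2_n(B)=(U,V\cup V',E)$ where $V'$ is a set of $n-|U|-|V|$ new vertices disjoint from $U\cup V$. (3) For a triple $B=(U,V,E)$ with $|E|\le m$, $\mathcal{G}^3_m(B)$ adds, uniformly at random, $m-|E|$ new edges, each joining a vertex of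 $U$ with a vertex of $U\cup V$, giving $(U,V,E\cup E')$. -}

module Defs where

open import Data.Nat using (ℕ; _+_; _≤_; _<_; _⊔_; _⊓_)
open import Data.Product using (Σ; ∃; _×_; _,_; proj₁; proj₂)
open import Data.Sum using (_⊎_)
open import Data.List using (List; []; _∷_; _++_; map; length; concat; sum)
open import Data.List.Membership.Propositional using (_∈_)
open import Data.List.Relation.Unary.All using (All)
open import Data.List.Relation.Unary.AllPairs using (AllPairs)
open import Data.List.Relation.Unary.Unique.Propositional using (Unique)
open import Data.List.Relation.Binary.Disjoint.Propositional using (Disjoint)
open import Data.List.Relation.Binary.Permutation.Propositional using (_↭_)
open import Function.Definitions using (Injective)
open import Relation.Binary.PropositionalEquality using (_≡_)

-- Vertices are natural numbers; an edge {a,b} is stored normalised as a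
-- pair (a , b) with a < b.
Vertex : Set
Vertex = ℕ

Edge : Set
Edge = Vertex × Vertex

-- A triple (U, V, E) with finite vertex sets U, V and edge set E,
-- each represented as a duplicate-free list.
record Triple : Set where
  constructor triple
  field
    U : List Vertex
    V : List Vertex
    E : List Edge
open Triple public

Verts : Triple → List Vertex
Verts B = U B ++ V B

EdgeOn : List Vertex → Edge → Set
EdgeOn W e = (proj₁ e < proj₂ e) × (proj₁ e ∈ W) × (proj₂ e ∈ W)

WellFormed : Triple → Set
WellFormed B =
  Unique (U B) × Unique (V B) × Disjoint (U B) (V B)
  × Unique (E B) × All (EdgeOn (Verts B)) (E B)

IsVertexCover : List Vertex → List Edge → List Vertex → Set
IsVertexCover W F S =
  All (_∈ W) S × All (λ e → proj₁ e ∈ S ⊎ proj₂ e ∈ S) F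

IsMinVertexCover : List Vertex → List Edge → List Vertex → Set
IsMinVertexCover W F S =
  Unique S × IsVertexCover W F S
  × (∀ (T : List Vertex) → Unique T → IsVertexCover W F T → length S ≤ length T)

UMinCover : Triple → Set
UMinCover B = IsMinVertexCover (Verts B) (E B) (U B)

mapEdge : (Vertex → Vertex) → Edge → Edge
mapEdge f (a , b) = (f a ⊓ f b , f a ⊔ f b)

IsCopy : Triple → Triple → Set
IsCopy S B = Σ (Vertex → Vertex) λ f → Injective _≡_ _≡_ f
  × (U S ↭ map f (U B)) × (V S ↭ map f (V B)) × (E S ↭ map (mapEdge f) (E B))

VertexDisjoint : Triple → Triple → Set
VertexDisjoint S T = Disjoint (Verts S) (Verts T)


-- C(S₁,…,S_k): componentwise union of pairwise vertex-disjoint triples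
Cmb : List Triple → Triple
Cmb Ss = triple (concat (map U Ss)) (concat (map V Ss)) (concat (map E Ss))

-- Range (support) of 𝒢¹_{𝓑,ℓ,m,n}: collections of pairwise vertex-disjoint
-- copies of elements of 𝓑 (repetition allowed) with |⋃Uᵢ| = ℓ,
-- |⋃Vᵢ| + ℓ ≤ n, |⋃Eᵢ| ≤ m.
InRangeG1 : (Triple → Set) → ℕ → ℕ → ℕ → List Triple → Set
InRangeG1 𝓑 ℓ m n Ss =
  All (λ S → ∃ λ B → 𝓑 B × IsCopy S B) Ss
  × AllPairs VertexDisjoint Ss
  × length (concat (map U Ss)) ≡ ℓ
  × length (concat (map V Ss)) + ℓ ≤ n
  × length (concat (map E Ss)) ≤ m

InRangeG2 : ℕ → Triple → Triple → Set
InRangeG2 n B T = Σ (List Vertex) λ V' →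
  (length (U B) + length (V B) ≤ n)
  × Unique V' × Disjoint V' (Verts B)
  × length (U B) + length (V B) + length V' ≡ n
  × (T ≡ triple (U B) (V B ++ V') (E B))

EdgeFromU : Triple → Edge → Set
EdgeFromU B e = (proj₁ e < proj₂ e)
  × ((proj₁ e ∈ U B × proj₂ e ∈ Verts B) ⊎ (proj₂ e ∈ U B × proj₁ e ∈ Verts B))

InRangeG3 : ℕ → Triple → Triple → Set
InRangeG3 m B T = Σ (List Edge) λ E' →
  (length (E B) ≤ m)
  × Unique (E B ++ E') × All (EdgeFromU B) E'
  × length (E B) + length E' ≡ m
  × (T ≡ triple (U B) (V B) (E B ++ E'))

-- Range of 𝒢³_m(𝒢²_n(C(𝒢¹_{𝓑,ℓ,m,n})))
InRange : (Triple → Set) → ℕ → ℕ → ℕ → Triple → Set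
InRange 𝓑 ℓ m n T = Σ (List Triple) λ Ss → InRangeG1 𝓑 ℓ m n Ss
  × Σ Triple λ T₂ → InRangeG2 n (Cmb Ss) T₂ × InRangeG3 m T₂ T

-- Call a triple (U, V, E) a block when U, V are disjoint duplicate-free vertex
-- lists, E lies on U ∪ V and U is a minimum vertex cover.  Being a block is
-- invariant under renaming, and a vertex-disjoint union of blocks is a block,
-- because a cover of the union splits into covers of the parts.  Adding
-- isolated vertices to V keeps every cover a cover; adding edges incident to U
-- keeps U a cover and can only raise the size of the other covers.
module Submission where

open import Defs
open import Data.Nat using (ℕ; _≤_; _+_; _⊓_; _⊔_; suc; z≤n)
open import Data.Nat.Properties
  using (≤-total; m≤n⇒m⊓n≡m; m≥n⇒m⊓n≡n; m≤n⇒m⊔n≡n; m≥n⇒m⊔n≡m; m⊓n≤m⊔n; ≤∧≢⇒<;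
         <⇒≢; +-suc; +-assoc; +-mono-≤; _≟_; module ≤-Reasoning)
open import Data.Product using (_×_; _,_; proj₁; proj₂; ∃)
open import Data.Sum using (_⊎_; inj₁; inj₂) renaming (swap to ⊎-swap; map to ⊎-map)
open import Data.List using (List; []; _∷_; length; _++_; map; filter)
open import Data.List.Properties using (length-++; length-map; map-++; ++-identityʳ)
open import Data.List.Membership.Propositional using (_∈_)
open import Data.List.Membership.Propositional.Properties
  using (∈-map⁺; ∈-map⁻; ∈-++⁺ˡ; ∈-++⁺ʳ; ∈-++⁻; ∈-filter⁺; ∈-filter⁻)
open import Data.List.Membership.DecPropositional _≟_ using (_∈?_)
open import Data.List.Relation.Binary.Subset.Propositional using (_⊆_)
open import Data.List.Relation.Unary.All as All using (All; []; _∷_)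
import Data.List.Relation.Unary.All.Properties as All
open import Data.List.Relation.Unary.AllPairs using (AllPairs; []; _∷_)
open import Data.List.Relation.Unary.Unique.Propositional using (Unique)
import Data.List.Relation.Unary.Unique.Propositional.Properties as Unique
open import Data.List.Relation.Binary.Disjoint.Propositional using (Disjoint)
open import Data.List.Relation.Binary.Permutation.Propositional using (_↭_; ↭-sym; ↭⇒↭ₛ)
open import Data.List.Relation.Binary.Permutation.Propositional.Properties
  using (∈-resp-↭; All-resp-↭; ↭-length; ++⁺)
import Data.List.Relation.Binary.Permutation.Setoid.Properties as Permutationₛ
open import Data.Empty using (⊥-elim)
open import Function using (_∘_)
open import Function.Definitions using (Injective)
open import Relation.Unary using (Decidable)
open import Relation.Unary.Properties using (∁?)
open import Relation.Nullary using (yes; no)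
open import Relation.Binary.PropositionalEquality
  using (_≡_; _≢_; refl; sym; trans; cong; cong₂; subst; setoid; module ≡-Reasoning)

Unique-resp-↭ : {xs ys : List Vertex} → Unique xs → xs ↭ ys → Unique ys
Unique-resp-↭ u p = Permutationₛ.Unique-resp-↭ (setoid Vertex) (↭⇒↭ₛ p) u

length-filter+length-filter-∁ : {P : Vertex → Set} (P? : Decidable P) (xs : List Vertex)
  → length (filter P? xs) + length (filter (∁? P?) xs) ≡ length xs
length-filter+length-filter-∁ P? [] = refl
length-filter+length-filter-∁ P? (x ∷ xs) with P? x
... | yes _ = cong suc (length-filter+length-filter-∁ P? xs)
... | no _  = trans (+-suc _ _) (cong suc (length-filter+length-filter-∁ P? xs))

All-∈-map⁻ : (f : Vertex → Vertex) {W X : List Vertex}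
  → All (_∈ map f W) X → ∃ λ Y → All (_∈ W) Y × map f Y ≡ X
All-∈-map⁻ f [] = [] , [] , refl
All-∈-map⁻ f (x∈ ∷ X∈) with ∈-map⁻ f x∈ | All-∈-map⁻ f X∈
... | b , b∈ , refl | Y , Y∈ , refl = b ∷ Y , b∈ ∷ Y∈ , refl

⊓-⊔-intro : (P : ℕ → ℕ → Set) {x y : ℕ} → P x y → P y x → P (x ⊓ y) (x ⊔ y)
⊓-⊔-intro P {x} {y} pxy pyx with ≤-total x y
... | inj₁ x≤y rewrite m≤n⇒m⊓n≡m x≤y | m≤n⇒m⊔n≡n x≤y = pxy
... | inj₂ y≤x rewrite m≥n⇒m⊓n≡n y≤x | m≥n⇒m⊔n≡m y≤x = pyx

Cover : List Vertex → Edge → Set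
Cover X e = proj₁ e ∈ X ⊎ proj₂ e ∈ X

Covers : List Vertex → List Edge → Set
Covers X = All (Cover X)

Cover-mono : {X Y : List Vertex} {e : Edge} → X ⊆ Y → Cover X e → Cover Y e
Cover-mono X⊆Y (inj₁ a∈) = inj₁ (X⊆Y a∈)
Cover-mono X⊆Y (inj₂ b∈) = inj₂ (X⊆Y b∈)

EdgeOn-mono : {W W' : List Vertex} {e : Edge} → W ⊆ W' → EdgeOn W e → EdgeOn W' e
EdgeOn-mono W⊆W' (a<b , a∈ , b∈) = a<b , W⊆W' a∈ , W⊆W' b∈

Covers-filter : {P : Vertex → Set} (P? : Decidable P) {W X : List Vertex} {F : List Edge}
  → (∀ {x} → x ∈ W → P x) → All (EdgeOn W) F → Covers X F → Covers (filter P? X) F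
Covers-filter P? W⇒P [] [] = []
Covers-filter P? W⇒P ((_ , a∈ , _) ∷ on) (inj₁ a∈X ∷ cov) =
  inj₁ (∈-filter⁺ P? a∈X (W⇒P a∈)) ∷ Covers-filter P? W⇒P on cov
Covers-filter P? W⇒P ((_ , _ , b∈) ∷ on) (inj₂ b∈X ∷ cov) =
  inj₂ (∈-filter⁺ P? b∈X (W⇒P b∈)) ∷ Covers-filter P? W⇒P on cov

module _ (f : Vertex → Vertex) where

  mapEdge-EdgeOn : {W W' : List Vertex} {e : Edge} → Injective _≡_ _≡_ f
    → (∀ {x} → x ∈ W → f x ∈ W') → EdgeOn W e → EdgeOn W' (mapEdge f e)
  mapEdge-EdgeOn {W' = W'} {a , b} f-inj f[W]⊆W' (a<b , a∈ , b∈) =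
    ≤∧≢⇒< (m⊓n≤m⊔n (f a) (f b)) (proj₁ on) , proj₂ on
    where
    DistinctIn : ℕ → ℕ → Set
    DistinctIn u v = u ≢ v × u ∈ W' × v ∈ W'
    fa≢fb : f a ≢ f b
    fa≢fb fa≡fb = <⇒≢ a<b (f-inj fa≡fb)
    on : DistinctIn (f a ⊓ f b) (f a ⊔ f b)
    on = ⊓-⊔-intro DistinctIn (fa≢fb , f[W]⊆W' a∈ , f[W]⊆W' b∈)
                              (fa≢fb ∘ sym , f[W]⊆W' b∈ , f[W]⊆W' a∈)

  Cover-mapEdge⁺ : {Y : List Vertex} {e : Edge}
    → f (proj₁ e) ∈ Y ⊎ f (proj₂ e) ∈ Y → Cover Y (mapEdge f e)
  Cover-mapEdge⁺ {Y} c = ⊓-⊔-intro (λ u v → u ∈ Y ⊎ v ∈ Y) c (⊎-swap c)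

  Cover-mapEdge⁻ : {Y : List Vertex} {e : Edge}
    → Cover Y (mapEdge f e) → f (proj₁ e) ∈ Y ⊎ f (proj₂ e) ∈ Y
  Cover-mapEdge⁻ {Y} {a , b} =
    ⊓-⊔-intro (λ u v → u ∈ Y ⊎ v ∈ Y → f a ∈ Y ⊎ f b ∈ Y) (λ c → c) ⊎-swap

-- The hypotheses of the theorem minus uniqueness of E, which 𝒢³ supplies.
record Block (S : Triple) : Set where
  field
    U-unique     : Unique (U S)
    V-unique     : Unique (V S)
    U-V-disjoint : Disjoint (U S) (V S)
    edges-on     : All (EdgeOn (Verts S)) (E S)
    U-covers     : Covers (U S) (E S)
    U-minimum    : ∀ X → Unique X → All (_∈ Verts S) X → Covers X (E S) → length (U S) ≤ length X

WellFormed×UMinCover⇒Block : {B : Triple} → WellFormed B × UMinCover B → Block B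
WellFormed×UMinCover⇒Block ((uU , uV , U#V , _ , on) , (_ , (_ , cov) , min)) = record
  { U-unique     = uU
  ; V-unique     = uV
  ; U-V-disjoint = U#V
  ; edges-on     = on
  ; U-covers     = cov
  ; U-minimum    = λ X uX X⊆ covX → min X uX (X⊆ , covX)
  }

Block⇒WellFormed : {B : Triple} → Block B → Unique (E B) → WellFormed B
Block⇒WellFormed b uE = U-unique , V-unique , U-V-disjoint , uE , edges-on
  where open Block b

Block⇒UMinCover : {B : Triple} → Block B → UMinCover B
Block⇒UMinCover b = U-unique , (All.tabulate ∈-++⁺ˡ , U-covers) ,
  λ X uX (X⊆ , covX) → U-minimum X uX X⊆ covX
  where open Block b

Block-copy : {S B : Triple} → IsCopy S B → Block B → Block S
Block-copy {S} {B} (f , f-inj , U↭ , V↭ , E↭) b = record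
  { U-unique     = Unique-resp-↭ (Unique.map⁺ f-inj U-unique) (↭-sym U↭)
  ; V-unique     = Unique-resp-↭ (Unique.map⁺ f-inj V-unique) (↭-sym V↭)
  ; U-V-disjoint = U-V-disjoint′
  ; edges-on     = map-E (λ {e} → mapEdge-EdgeOn f {e = e} f-inj f[Verts]) edges-on
  ; U-covers     = map-E (λ {e} → Cover-mapEdge⁺ f {e = e} ∘ ⊎-map-f[U] {e}) U-covers
  ; U-minimum    = U-minimum′
  }
  where
  open Block b
  Verts↭ : Verts S ↭ map f (Verts B)
  Verts↭ = subst (Verts S ↭_) (sym (map-++ f (U B) (V B))) (++⁺ U↭ V↭)
  f[Verts] : ∀ {x} → x ∈ Verts B → f x ∈ Verts S
  f[Verts] = ∈-resp-↭ (↭-sym Verts↭) ∘ ∈-map⁺ f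
  f[U] : ∀ {x} → x ∈ U B → f x ∈ U S
  f[U] = ∈-resp-↭ (↭-sym U↭) ∘ ∈-map⁺ f
  ⊎-map-f[U] : ∀ {e} → Cover (U B) e → f (proj₁ e) ∈ U S ⊎ f (proj₂ e) ∈ U S
  ⊎-map-f[U] = ⊎-map f[U] f[U]
  map-E : {P : Edge → Set} {Q : Edge → Set} → (∀ {e} → P e → Q (mapEdge f e))
    → All P (E B) → All Q (E S)
  map-E P⇒Q ps = All-resp-↭ (↭-sym E↭) (All.map⁺ (All.map P⇒Q ps))
  U-V-disjoint′ : Disjoint (U S) (V S)
  U-V-disjoint′ (x∈U , x∈V) with ∈-map⁻ f (∈-resp-↭ U↭ x∈U) | ∈-map⁻ f (∈-resp-↭ V↭ x∈V)
  ... | a , a∈ , refl | b , b∈ , fa≡fb = U-V-disjoint (a∈ , subst (_∈ V B) (sym (f-inj fa≡fb)) b∈)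
  -- A cover X of S inside its vertices is the image of a cover Y of B of the same size.
  U-minimum′ : ∀ X → Unique X → All (_∈ Verts S) X → Covers X (E S) → length (U S) ≤ length X
  U-minimum′ X uX X⊆ covX with All-∈-map⁻ f (All.map (∈-resp-↭ Verts↭) X⊆)
  ... | Y , Y⊆ , refl = begin
    length (U S)       ≡⟨ trans (↭-length U↭) (length-map f (U B)) ⟩
    length (U B)       ≤⟨ U-minimum Y (Unique.map⁻ uX) Y⊆ covY ⟩
    length Y           ≡⟨ sym (length-map f Y) ⟩
    length (map f Y)   ∎
    where
    open ≤-Reasoning
    pull : ∀ {x} → f x ∈ map f Y → x ∈ Y
    pull fx∈ with ∈-map⁻ f fx∈
    ... | y , y∈ , fx≡fy = subst (_∈ Y) (sym (f-inj fx≡fy)) y∈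
    covY : Covers Y (E B)
    covY = All.tabulate λ {e} e∈ →
      ⊎-map pull pull (Cover-mapEdge⁻ f {e = e} (All.lookup covX (∈-resp-↭ (↭-sym E↭) (∈-map⁺ (mapEdge f) e∈))))

_⊕_ : Triple → Triple → Triple
S ⊕ T = triple (U S ++ U T) (V S ++ V T) (E S ++ E T)

∈-Verts-⊕⁻ : (S T : Triple) {x : Vertex} → x ∈ Verts (S ⊕ T) → x ∈ Verts S ⊎ x ∈ Verts T
∈-Verts-⊕⁻ S T x∈ with ∈-++⁻ (U S ++ U T) x∈
... | inj₁ x∈U = ⊎-map ∈-++⁺ˡ ∈-++⁺ˡ (∈-++⁻ (U S) x∈U)
... | inj₂ x∈V = ⊎-map (∈-++⁺ʳ (U S)) (∈-++⁺ʳ (U T)) (∈-++⁻ (V S) x∈V)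

Verts-⊕⁺ˡ : (S T : Triple) → Verts S ⊆ Verts (S ⊕ T)
Verts-⊕⁺ˡ S T x∈ with ∈-++⁻ (U S) x∈
... | inj₁ x∈U = ∈-++⁺ˡ (∈-++⁺ˡ x∈U)
... | inj₂ x∈V = ∈-++⁺ʳ (U S ++ U T) (∈-++⁺ˡ x∈V)

Verts-⊕⁺ʳ : (S T : Triple) → Verts T ⊆ Verts (S ⊕ T)
Verts-⊕⁺ʳ S T x∈ with ∈-++⁻ (U T) x∈
... | inj₁ x∈U = ∈-++⁺ˡ (∈-++⁺ʳ (U S) x∈U)
... | inj₂ x∈V = ∈-++⁺ʳ (U S ++ U T) (∈-++⁺ʳ (V S) x∈V)

Block-⊕ : {S T : Triple} → VertexDisjoint S T → Block S → Block T → Block (S ⊕ T)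
Block-⊕ {S} {T} S#T bS bT = record
  { U-unique     = Unique.++⁺ (U-unique bS) (U-unique bT) (λ (x∈S , x∈T) → S#T (∈-++⁺ˡ x∈S , ∈-++⁺ˡ x∈T))
  ; V-unique     = Unique.++⁺ (V-unique bS) (V-unique bT)
                     (λ (x∈S , x∈T) → S#T (∈-++⁺ʳ (U S) x∈S , ∈-++⁺ʳ (U T) x∈T))
  ; U-V-disjoint = U-V-disjoint′
  ; edges-on     = All.++⁺ (All.map (EdgeOn-mono (Verts-⊕⁺ˡ S T)) (edges-on bS))
                           (All.map (EdgeOn-mono (Verts-⊕⁺ʳ S T)) (edges-on bT))
  ; U-covers     = All.++⁺ (All.map (Cover-mono ∈-++⁺ˡ) (U-covers bS))
                           (All.map (Cover-mono (∈-++⁺ʳ (U S))) (U-covers bT))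
  ; U-minimum    = U-minimum′
  }
  where
  open Block
  U-V-disjoint′ : Disjoint (U S ++ U T) (V S ++ V T)
  U-V-disjoint′ (x∈U , x∈V) with ∈-++⁻ (U S) x∈U | ∈-++⁻ (V S) x∈V
  ... | inj₁ x∈US | inj₁ x∈VS = U-V-disjoint bS (x∈US , x∈VS)
  ... | inj₁ x∈US | inj₂ x∈VT = S#T (∈-++⁺ˡ x∈US , ∈-++⁺ʳ (U T) x∈VT)
  ... | inj₂ x∈UT | inj₁ x∈VS = S#T (∈-++⁺ʳ (U S) x∈VS , ∈-++⁺ˡ x∈UT)
  ... | inj₂ x∈UT | inj₂ x∈VT = U-V-disjoint bT (x∈UT , x∈VT)
  -- Split a cover X of S ⊕ T into its vertices inside S and the rest, which lie in T.
  U-minimum′ : ∀ X → Unique X → All (_∈ Verts (S ⊕ T)) X → Covers X (E S ++ E T)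
    → length (U S ++ U T) ≤ length X
  U-minimum′ X uX X⊆ covX = begin
    length (U S ++ U T)                      ≡⟨ length-++ (U S) ⟩
    length (U S) + length (U T)              ≤⟨ +-mono-≤ minS minT ⟩
    length (filter inS? X) + length (filter (∁? inS?) X)
                                             ≡⟨ length-filter+length-filter-∁ inS? X ⟩
    length X                                 ∎
    where
    open ≤-Reasoning
    inS? = _∈? Verts S
    minS : length (U S) ≤ length (filter inS? X)
    minS = U-minimum bS _ (Unique.filter⁺ inS? uX)
      (All.tabulate (proj₂ ∘ ∈-filter⁻ inS? {xs = X}))
      (Covers-filter inS? (λ x∈ → x∈) (edges-on bS) (All.++⁻ˡ (E S) covX))
    inT : ∀ {x} → x ∈ filter (∁? inS?) X → x ∈ Verts T
    inT x∈ with ∈-filter⁻ (∁? inS?) {xs = X} x∈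
    ... | x∈X , x∉S with ∈-Verts-⊕⁻ S T (All.lookup X⊆ x∈X)
    ...   | inj₁ x∈S = ⊥-elim (x∉S x∈S)
    ...   | inj₂ x∈T = x∈T
    minT : length (U T) ≤ length (filter (∁? inS?) X)
    minT = U-minimum bT _ (Unique.filter⁺ (∁? inS?) uX) (All.tabulate inT)
      (Covers-filter (∁? inS?) (λ x∈T x∈S → S#T (x∈S , x∈T)) (edges-on bT) (All.++⁻ʳ (E S) covX))

Block-edgeless : (V' : List Vertex) → Unique V' → Block (triple [] V' [])
Block-edgeless V' uV' = record
  { U-unique     = []
  ; V-unique     = uV'
  ; U-V-disjoint = λ ()
  ; edges-on     = []
  ; U-covers     = []
  ; U-minimum    = λ _ _ _ _ → z≤n
  }

VertexDisjoint-Cmb : {S : Triple} {Ss : List Triple} → All (VertexDisjoint S) Ss → VertexDisjoint S (Cmb Ss)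
VertexDisjoint-Cmb [] (_ , ())
VertexDisjoint-Cmb {S} {S' ∷ Ss} (S#S' ∷ S#Ss) (x∈S , x∈Ss) with ∈-Verts-⊕⁻ S' (Cmb Ss) x∈Ss
... | inj₁ x∈S' = S#S' (x∈S , x∈S')
... | inj₂ x∈Ss = VertexDisjoint-Cmb {S} S#Ss (x∈S , x∈Ss)

Block-Cmb : {Ss : List Triple} → AllPairs VertexDisjoint Ss → All Block Ss → Block (Cmb Ss)
Block-Cmb [] [] = Block-edgeless [] []
Block-Cmb {S ∷ _} (S#Ss ∷ disjoint) (bS ∷ bSs) =
  Block-⊕ (VertexDisjoint-Cmb {S} S#Ss) bS (Block-Cmb disjoint bSs)

Block-addVertices : {B : Triple} {V' : List Vertex} → Unique V' → Disjoint V' (Verts B)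
  → Block B → Block (triple (U B) (V B ++ V') (E B))
Block-addVertices {B} {V'} uV' V'#B b =
  subst Block (cong₂ (λ U' E' → triple U' (V B ++ V') E') (++-identityʳ (U B)) (++-identityʳ (E B)))
    (Block-⊕ (λ (x∈B , x∈V') → V'#B (x∈V' , x∈B)) b (Block-edgeless V' uV'))

Block-addEdges : {B : Triple} {E' : List Edge} → All (EdgeFromU B) E'
  → Block B → Block (triple (U B) (V B) (E B ++ E'))
Block-addEdges {B} {E'} E'⊆ b = record
  { U-unique     = U-unique
  ; V-unique     = V-unique
  ; U-V-disjoint = U-V-disjoint
  ; edges-on     = All.++⁺ edges-on (All.map EdgeFromU⇒EdgeOn E'⊆)
  ; U-covers     = All.++⁺ U-covers (All.map EdgeFromU⇒Cover E'⊆)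
  ; U-minimum    = λ X uX X⊆ covX → U-minimum X uX X⊆ (All.++⁻ˡ (E B) covX)
  }
  where
  open Block b
  EdgeFromU⇒EdgeOn : ∀ {e} → EdgeFromU B e → EdgeOn (Verts B) e
  EdgeFromU⇒EdgeOn (a<b , inj₁ (a∈U , b∈)) = a<b , ∈-++⁺ˡ a∈U , b∈
  EdgeFromU⇒EdgeOn (a<b , inj₂ (b∈U , a∈)) = a<b , a∈ , ∈-++⁺ˡ b∈U
  EdgeFromU⇒Cover : ∀ {e} → EdgeFromU B e → Cover (U B) e
  EdgeFromU⇒Cover (_ , inj₁ (a∈U , _)) = inj₁ a∈U
  EdgeFromU⇒Cover (_ , inj₂ (b∈U , _)) = inj₂ b∈U

theorem2 : (𝓑 : Triple → Set)
    → (∀ B → 𝓑 B → WellFormed B × UMinCover B)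
    → (ℓ m n : ℕ) → (T : Triple) → InRange 𝓑 ℓ m n T
    → WellFormed T × UMinCover T × length (U T) ≡ ℓ
      × length (U T ++ V T) ≡ n × length (E T) ≡ m
theorem2 𝓑 𝓑-blocks ℓ m n T
    (Ss , (copies , disjoint , |U|≡ℓ , _ , _) , _
        , (V' , _ , V'-unique , V'-fresh , |U|+|V|+|V'|≡n , refl)
        , (E' , _ , E-unique , E'-from-U , |E|+|E'|≡m , refl)) =
  Block⇒WellFormed block E-unique , Block⇒UMinCover block , |U|≡ℓ ,
  vertex-count , trans (length-++ (E C)) |E|+|E'|≡m
  where
  C = Cmb Ss
  block : Block T
  block = Block-addEdges E'-from-U (Block-addVertices V'-unique V'-fresh (Block-Cmb disjoint
    (All.map (λ (B , B∈𝓑 , copy) → Block-copy copy (WellFormed×UMinCover⇒Block (𝓑-blocks B B∈𝓑))) copies)))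
  vertex-count : length (U C ++ V C ++ V') ≡ n
  vertex-count = begin
    length (U C ++ V C ++ V')                   ≡⟨ length-++ (U C) ⟩
    length (U C) + length (V C ++ V')           ≡⟨ cong (length (U C) +_) (length-++ (V C)) ⟩
    length (U C) + (length (V C) + length V')   ≡⟨ sym (+-assoc (length (U C)) _ _) ⟩
    length (U C) + length (V C) + length V'     ≡⟨ |U|+|V|+|V'|≡n ⟩
    n                                           ∎
    where open ≡-Reasoning
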